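{- Let $(X,\mathcal{T},(I_i)_{i\in\mathbb{N}})$ be a computable topological space and let $A_0,\dots,A_n,S_0,\dots,S_n$ be subsets of $X$ such that $A_i$ is c.e. up to $S_i$ for each $i\in\{0,\dots,n\}$. Then $A_0\cup\dots\cup A_n$ is c.e. up to $S_0\cup\dots\cup S_n$. In particular, if $A_0,\dots,A_n$ are c.e. up to a set $S$, then $A_0\cup\dots\cup A_n$ is c.e. up to $S$.
   Context: A computable topological space is a triple $(X,\mathcal{T},(I_i))$ with $(X,\mathcal{T})$ a topological space, $\{I_i\}\subseteq\mathcal{T}$ a basis, and c.e. sets $\mathcal{C},\mathcal{D}\subseteq\mathbb{N}^2$ such that: (1) $(i,j)\in\mathcal{D}\Rightarrow I_i\cap I_j=\emptyset$; (2) $(i,j)\in\mathcal{C}\Rightarrow I_i\subseteq I_j$; (3) for $x\neq y$ there are $i,j$ with $x\in I_i$, $y\in I_j$, $(i,j)\in\mathcal{D}$; (4) if $x\in I_i\cap I_j$ there is $k$ with $x\in I_k$, $(k,i),(k,j)\in\mathcal{C}$. For $A\subseteq S\subseteq X$, $A$ is c.e. up to $S$ if there is a c.e. set $\Omega\subseteq\mathbb{N}$ such that for each $i\in\mathbb{N}$: $I_i\cap A\neq\emptyset\Rightarrow i\in\Omega$, and $i\in\Omega\Rightarrow I_i\cap S\neq\emptyset$. -}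

module Defs where

open import Data.Nat using (ℕ; zero; suc)
open import Data.Fin using (Fin)
open import Data.Vec using (Vec; []; _∷_; lookup)
open import Data.Product using (Σ; _×_; ∃; _,_)
open import Data.Unit using (⊤)
open import Data.Empty using (⊥)
open import Relation.Binary.PropositionalEquality using (_≡_)
open import Function.Bundles using (_⇔_)

data PR : ℕ → Set where
  zeroF : PR 0
  succF : PR 1
  projF : ∀ {k} → Fin k → PR k
  compF : ∀ {k m} → PR m → Vec (PR k) m → PR k
  recF  : ∀ {k} → PR k → PR (suc (suc k)) → PR (suc k)

mutual
  eval : ∀ {k} → PR k → Vec ℕ k → ℕ
  eval zeroF        _  = 0
  eval succF        (x ∷ []) = suc x
  eval (projF i)    xs = lookup xs i
  eval (compF f gs) xs = eval f (evalAll gs xs)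
  eval (recF f g)   (zero  ∷ xs) = eval f xs
  eval (recF f g)   (suc n ∷ xs) = eval g (n ∷ eval (recF f g) (n ∷ xs) ∷ xs)

  evalAll : ∀ {k m} → Vec (PR k) m → Vec ℕ k → Vec ℕ m
  evalAll []       xs = []
  evalAll (g ∷ gs) xs = eval g xs ∷ evalAll gs xs

-- A set Ω ⊆ ℕ is computably enumerable iff it is Σ⁰₁:
-- Ω = { n | ∃ m. f(n, m) = 0 } for some primitive recursive f.
CE : (ℕ → Set) → Set
CE Ω = Σ (PR 2) λ f → ∀ n → Ω n ⇔ (∃ λ m → eval f (n ∷ m ∷ []) ≡ 0)

CE₂ : (ℕ → ℕ → Set) → Set
CE₂ Ω = Σ (PR 3) λ f → ∀ i j → Ω i j ⇔ (∃ λ m → eval f (i ∷ j ∷ m ∷ []) ≡ 0)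

Subset : Set → Set₁
Subset X = X → Set

_⊆_ : {X : Set} → Subset X → Subset X → Set
A ⊆ B = ∀ {x} → A x → B x

_∩_ : {X : Set} → Subset X → Subset X → Subset X
(A ∩ B) x = A x × B x

Nonempty : {X : Set} → Subset X → Set
Nonempty {X} A = Σ X A

⋃Fin : {X : Set} (n : ℕ) → (Fin (suc n) → Subset X) → Subset X
⋃Fin n A x = Σ (Fin (suc n)) λ i → A i x

record IsTopology (X : Set) (T : Subset X → Set) : Set₁ where
  field
    whole : T (λ _ → ⊤)
    empty : T (λ _ → ⊥)
    unions : (J : Set) (U : J → Subset X) → (∀ j → T (U j)) →
             T (λ x → Σ J λ j → U j x)
    inter : (U V : Subset X) → T U → T V → T (U ∩ V)

IsBasis : {X : Set} → (Subset X → Set) → (ℕ → Subset X) → Set₁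
IsBasis {X} T I =
  (∀ i → T (I i)) ×
  (∀ (U : Subset X) → T U → ∀ x → U x → Σ ℕ λ i → I i x × I i ⊆ U)

record ComputableTopologicalSpace (X : Set) (T : Subset X → Set)
                                  (I : ℕ → Subset X) : Set₁ where
  field
    isTopology : IsTopology X T
    isBasis    : IsBasis T I
    𝒞 𝒟        : ℕ → ℕ → Set
    𝒞-ce       : CE₂ 𝒞
    𝒟-ce       : CE₂ 𝒟
    𝒟-disj     : ∀ i j → 𝒟 i j → ∀ x → I i x → I j x → ⊥
    𝒞-incl     : ∀ i j → 𝒞 i j → I i ⊆ I j
    separate   : ∀ x y → (x ≡ y → ⊥) →
                 Σ ℕ λ i → Σ ℕ λ j → I i x × I j y × 𝒟 i j
    refine     : ∀ x i j → I i x → I j x →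
                 Σ ℕ λ k → I k x × 𝒞 k i × 𝒞 k j

CEUpTo : {X : Set} → (ℕ → Subset X) → Subset X → Subset X → Set₁
CEUpTo I A S =
  A ⊆ S ×
  Σ (ℕ → Set) λ Ω → CE Ω ×
    (∀ i → Nonempty (I i ∩ A) → Ω i) ×
    (∀ i → Ω i → Nonempty (I i ∩ S))

-- Each Aᵢ comes with a c.e. witness Ωᵢ; the union of the Ωᵢ witnesses the union of
-- the Aᵢ, and it is c.e. because ∃m. fᵢ(k,m) = 0 for some i iff ∃m. ∏ᵢ fᵢ(k,m) = 0.
-- The second claim is the first with Sᵢ = S, since S ∪ … ∪ S ⊆ S and c.e. up to S
-- is monotone in S.
module Submission where

open import Defs
open import Data.Nat using (ℕ; zero; suc; _+_; _*_)
open import Data.Nat.Properties using (+-comm; *-zeroʳ; m*n≡0⇒m≡0∨n≡0)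
open import Data.Fin using (Fin; zero; suc)
open import Data.Product using (Σ; _×_; _,_)
open import Data.Sum using (inj₁; inj₂)
open import Data.Vec using (Vec; []; _∷_)
open import Function.Bundles using (_⇔_; mk⇔; Equivalence)
open import Relation.Binary.PropositionalEquality using (_≡_; refl; cong)

addPR : PR 2
addPR = recF (projF zero) (compF succF (projF (suc zero) ∷ []))

eval-addPR : ∀ x y → eval addPR (x ∷ y ∷ []) ≡ x + y
eval-addPR zero    y = refl
eval-addPR (suc x) y = cong suc (eval-addPR x y)

mulPR : PR 2
mulPR = recF (compF zeroF [])
             (compF addPR (projF (suc zero) ∷ projF (suc (suc zero)) ∷ []))

eval-mulPR : ∀ x y → eval mulPR (x ∷ y ∷ []) ≡ x * y
eval-mulPR zero    y = refl
eval-mulPR (suc x) y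
  rewrite eval-addPR (eval mulPR (x ∷ y ∷ [])) y | eval-mulPR x y = +-comm (x * y) y

productPR : ∀ {k} n → (Fin (suc n) → PR k) → PR k
productPR zero    f = f zero
productPR (suc n) f = compF mulPR (f zero ∷ productPR n (λ i → f (suc i)) ∷ [])

eval-productPR≡0⇒∃ : ∀ {k} n (f : Fin (suc n) → PR k) xs →
                     eval (productPR n f) xs ≡ 0 → Σ (Fin (suc n)) λ i → eval (f i) xs ≡ 0
eval-productPR≡0⇒∃ zero    f xs e = zero , e
eval-productPR≡0⇒∃ (suc n) f xs e
  rewrite eval-mulPR (eval (f zero) xs) (eval (productPR n (λ i → f (suc i))) xs)
  with m*n≡0⇒m≡0∨n≡0 (eval (f zero) xs) e
... | inj₁ head≡0 = zero , head≡0
... | inj₂ tail≡0 with eval-productPR≡0⇒∃ n (λ i → f (suc i)) xs tail≡0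
...   | i , fi≡0 = suc i , fi≡0

∃⇒eval-productPR≡0 : ∀ {k} n (f : Fin (suc n) → PR k) xs (i : Fin (suc n)) →
                     eval (f i) xs ≡ 0 → eval (productPR n f) xs ≡ 0
∃⇒eval-productPR≡0 zero    f xs zero    e = e
∃⇒eval-productPR≡0 (suc n) f xs zero    e
  rewrite eval-mulPR (eval (f zero) xs) (eval (productPR n (λ i → f (suc i))) xs) | e = refl
∃⇒eval-productPR≡0 (suc n) f xs (suc i) e
  rewrite eval-mulPR (eval (f zero) xs) (eval (productPR n (λ i → f (suc i))) xs)
        | ∃⇒eval-productPR≡0 n (λ i → f (suc i)) xs i e = *-zeroʳ (eval (f zero) xs)

CE-⋃ : ∀ n (Ω : Fin (suc n) → ℕ → Set) → (∀ i → CE (Ω i)) →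
       CE (λ k → Σ (Fin (suc n)) λ i → Ω i k)
CE-⋃ n Ω ce = productPR n f , λ k → mk⇔
  (λ { (i , ω) → let (m , e) = Equivalence.to (spec i k) ω in
                 m , ∃⇒eval-productPR≡0 n f (k ∷ m ∷ []) i e })
  (λ { (m , e) → let (i , e′) = eval-productPR≡0⇒∃ n f (k ∷ m ∷ []) e in
                 i , Equivalence.from (spec i k) (m , e′) })
  where
  f : Fin (suc n) → PR 2
  f i = let (fᵢ , _) = ce i in fᵢ
  spec : ∀ i k → Ω i k ⇔ (Σ ℕ λ m → eval (f i) (k ∷ m ∷ []) ≡ 0)
  spec i = let (_ , specᵢ) = ce i in specᵢ

CEUpTo-⋃ : {X : Set} {I : ℕ → Subset X} (n : ℕ) (A S : Fin (suc n) → Subset X) →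
           (∀ i → CEUpTo I (A i) (S i)) → CEUpTo I (⋃Fin n A) (⋃Fin n S)
CEUpTo-⋃ {I = I} n A S h =
  (λ { (i , a) → i , A⊆S i a }) ,
  (λ k → Σ (Fin (suc n)) λ i → Ω i k) ,
  CE-⋃ n Ω (λ i → let (_ , _ , ce , _) = h i in ce) ,
  (λ { k (x , Ix , i , a) → i , meets⇒Ω i k (x , Ix , a) }) ,
  (λ { k (i , ω) → let (x , Ix , s) = Ω⇒meets i k ω in x , Ix , i , s })
  where
  A⊆S : ∀ i → A i ⊆ S i
  A⊆S i = let (A⊆S , _) = h i in A⊆S
  Ω : Fin (suc n) → ℕ → Set
  Ω i = let (_ , Ω , _) = h i in Ω
  meets⇒Ω : ∀ i k → Nonempty (I k ∩ A i) → Ω i k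
  meets⇒Ω i = let (_ , _ , _ , p , _) = h i in p
  Ω⇒meets : ∀ i k → Ω i k → Nonempty (I k ∩ S i)
  Ω⇒meets i = let (_ , _ , _ , _ , q) = h i in q

CEUpTo-mono : {X : Set} {I : ℕ → Subset X} {A S S′ : Subset X} →
              S ⊆ S′ → CEUpTo I A S → CEUpTo I A S′
CEUpTo-mono S⊆S′ (A⊆S , Ω , ce , meets⇒Ω , Ω⇒meets) =
  (λ a → S⊆S′ (A⊆S a)) , Ω , ce , meets⇒Ω ,
  λ k ω → let (x , Ix , s) = Ω⇒meets k ω in x , Ix , S⊆S′ s

proposition5p1 : {X : Set} {T : Subset X → Set} {I : ℕ → Subset X} →
    ComputableTopologicalSpace X T I → (n : ℕ) →
    ((A S : Fin (suc n) → Subset X) →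
      (∀ i → CEUpTo I (A i) (S i)) →
      CEUpTo I (⋃Fin n A) (⋃Fin n S)) ×
    ((A : Fin (suc n) → Subset X) (S : Subset X) →
      (∀ i → CEUpTo I (A i) S) →
      CEUpTo I (⋃Fin n A) S)
proposition5p1 _ n =
  CEUpTo-⋃ n ,
  λ A S h → CEUpTo-mono (λ { (_ , s) → s }) (CEUpTo-⋃ n A (λ _ → S) h)
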